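{- There is a constant $c>0$ and an infinite family of instances $(\mathcal{G}_n,T_{\max,n},\delta_n)_{n\in\mathbb{N}}$, with $|E(\mathcal{G}_n)|\to\infty$, such that for every $k\in\mathbb{N}^+$ the witness complexity of $\mathcal{G}_n$ (with parameters $T_{\max,n},\delta_n,k$) is at least $c\,|E(\mathcal{G}_n)|$; i.e., the witness complexity grows in $\Omega(|E(\mathcal{G}_n)|)$ independently of $k$.
   Context: A simple temporal graph $\mathcal{G}=(V,E,\lambda)$ with lifetime $T_{\max}$ is a finite simple undirected graph $(V,E)$ with a labeling $\lambda\colon E\to\{1,\dots,T_{\max}\}$; edge $e$ exists only at time step $\lambda(e)$. SIR infection model with parameter $\delta\in\mathbb{N}^+$: given a set $S\subseteq V\times\{0,\dots,T_{\max}\}$ of seed infections, all nodes start susceptible; a seed $(v,t)$ makes $v$ infected at time $t$ (if still susceptible); a susceptible node $u$ becomes infected at time $t$ iff some neighbor $v$ is infectious at time $t$ and $\lambda(uv)=t$ (if several, by exactly one of them, arbitrarily). A node infected at time $t$ is infectious at time steps $t+1,\dots,t+\delta$ and resistant afterwards. An infection log records which node infected which node at which time (and the seed infections). A witnessing schedule of length $a$ for $\mathcal{G}$ (with parameters $T_{\max},\delta,k$) is a sequence $S_1,\dots,S_a$ of seed infection sets, each of size at most $k$, such that after performing $a$ rounds with these seed sets, the resulting infection logs determine all labels uniquely, i.e., no other labeling of the static graph $(V,E)$ is consistent with these seed sets and logs. The witness complexity of $\mathcal{G}$ is the length of a shortest witnessing schedule. -}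

module Defs where

open import Data.Nat using (ℕ; zero; suc; _+_; _*_; _≤_; _<_)
open import Data.Fin using (Fin)
open import Data.Product using (Σ; ∃; ∃-syntax; _×_; _,_; proj₁; proj₂)
open import Data.Sum using (_⊎_)
open import Data.Maybe using (Maybe; just; nothing)
open import Data.List using (List; length)
open import Data.List.Membership.Propositional using (_∈_)
open import Relation.Binary.PropositionalEquality using (_≡_; _≢_)

record SimpleGraph : Set where
  field
    nV       : ℕ
    nE       : ℕ
    ends     : Fin nE → Fin nV × Fin nV
    loopless : ∀ e → proj₁ (ends e) ≢ proj₂ (ends e)
    noMulti  : ∀ e e' →
               (ends e ≡ ends e' ⊎ ends e ≡ (proj₂ (ends e') , proj₁ (ends e'))) →
               e ≡ e'
open SimpleGraph public

Joins : (G : SimpleGraph) → Fin (nE G) → Fin (nV G) → Fin (nV G) → Set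
Joins G e u w = ends G e ≡ (u , w) ⊎ ends G e ≡ (w , u)

Labeling : SimpleGraph → Set
Labeling G = Fin (nE G) → ℕ

ValidLabeling : (G : SimpleGraph) → ℕ → Labeling G → Set
ValidLabeling G Tmax lab = ∀ e → 1 ≤ lab e × lab e ≤ Tmax

record TemporalGraph : Set where
  field
    graph    : SimpleGraph
    Tmax     : ℕ
    label    : Labeling graph
    labelOK  : ValidLabeling graph Tmax label
open TemporalGraph public

SeedSet : SimpleGraph → Set
SeedSet G = List (Fin (nV G) × ℕ)

ValidSeedSet : (G : SimpleGraph) → ℕ → ℕ → SeedSet G → Set
ValidSeedSet G Tmax k S = length S ≤ k × (∀ v t → (v , t) ∈ S → t ≤ Tmax)

data Cause (n : ℕ) : Set where
  seed : Cause n
  by   : Fin n → Cause n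

-- An infection log: for every node, either it never got infected
-- (nothing) or it got infected at time t with the given cause.
Log : SimpleGraph → Set
Log G = Fin (nV G) → Maybe (ℕ × Cause (nV G))

InfectedAt : (G : SimpleGraph) → Log G → Fin (nV G) → ℕ → Set
InfectedAt G L v t = ∃[ c ] L v ≡ just (t , c)

Infectious : (G : SimpleGraph) → ℕ → Log G → Fin (nV G) → ℕ → Set
Infectious G δ L v t = ∃[ t' ] InfectedAt G L v t' × t' < t × t ≤ t' + δ

InfectedBy : (G : SimpleGraph) → Log G → Fin (nV G) → ℕ → Set
InfectedBy G L v t = ∃[ t' ] InfectedAt G L v t' × t' ≤ t

Trigger : (G : SimpleGraph) → Labeling G → ℕ → SeedSet G → Log G →
          Fin (nV G) → ℕ → Set
Trigger G lab δ S L u t =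
  (u , t) ∈ S ⊎
  (∃[ w ] ∃[ e ] Joins G e u w × lab e ≡ t × Infectious G δ L w t)

-- L is a possible outcome (infection log) of one SIR round on the static
-- graph G with labeling lab, parameter δ and seed set S.
-- (The choice among several simultaneous possible infectors is arbitrary.)
record PossibleLog (G : SimpleGraph) (lab : Labeling G) (δ : ℕ)
                   (S : SeedSet G) (L : Log G) : Set where
  field
    seedSound  : ∀ u t → L u ≡ just (t , seed) → (u , t) ∈ S
    byInfSound : ∀ u w t → L u ≡ just (t , by w) →
                 ∃[ e ] Joins G e u w × lab e ≡ t × Infectious G δ L w t
    -- a susceptible node with a trigger at time t gets infected at t;
    -- i.e. a trigger at time t means u is infected at some time ≤ t
    complete   : ∀ u t → Trigger G lab δ S L u t → InfectedBy G L u t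

WitnessingSchedule : (TG : TemporalGraph) (δ k a : ℕ) →
                     (Fin a → SeedSet (graph TG)) → Set
WitnessingSchedule TG δ k a S =
  (∀ i → ValidSeedSet (graph TG) (Tmax TG) k (S i)) ×
  (∀ (L : Fin a → Log (graph TG)) →
     (∀ i → PossibleLog (graph TG) (label TG) δ (S i) (L i)) →
     ∀ (lab' : Labeling (graph TG)) →
     ValidLabeling (graph TG) (Tmax TG) lab' →
     (∀ i → PossibleLog (graph TG) lab' δ (S i) (L i)) →
     ∀ e → lab' e ≡ label TG e)

-- "witness complexity of TG (params δ, k) is at least (p / q) * m":
-- every witnessing schedule has length a with (p / q) * m ≤ a,
-- i.e. p * m ≤ q * a (an infinite complexity satisfies every bound).
WitnessComplexity≥ : (TG : TemporalGraph) (δ k p q m : ℕ) → Set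
WitnessComplexity≥ TG δ k p q m =
  ∀ a (S : Fin a → SeedSet (graph TG)) → WitnessingSchedule TG δ k a S →
  p * m ≤ q * a

-- An instance (G_n, Tmax_n, δ_n): Tmax is part of the temporal graph.
record Instance : Set where
  field
    tgraph : TemporalGraph
    delta  : ℕ
    deltaPos : 1 ≤ delta
open Instance public

numEdges : Instance → ℕ
numEdges I = nE (graph (tgraph I))

-- The instances are stars with m ≥ 2 leaves, edge i labelled i + 1, and δ = 1. A witnessing
-- schedule must pin down the labels for every possible outcome of its rounds, so it suffices to
-- exhibit one possible log per round (an earliest-infection run). In a round the center is
-- infected at most once, say at time t, so its log can reveal at most two labels: that of the edge
-- it was infected through and the label t + 1 of the edge along which it may infect next. With a
-- rounds and 2a + 1 < m, some edge e never carries a recorded infection, and some j + 1 ≠ λ(e) in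
-- {1..m} is such that neither endpoint of e is ever infected at time j; relabelling e with j + 1 is
-- then consistent with all the logs. Hence m ≤ 2a + 1 ≤ 3a, whatever k is.
module Submission where

open import Defs
open import Data.Nat using (ℕ; zero; suc; _+_; _*_; _≤_; _<_; z≤n; s≤s; _≟_)
open import Data.Nat.Properties
  using (≤-refl; ≤-reflexive; ≤-trans; ≤-antisym; ≤-pred; <-irrefl; <⇒≢; n≤1+n; m≤n⇒m≤1+n;
         +-mono-≤; +-monoˡ-≤; +-comm; *-comm; *-identityˡ; suc-injective; ≮⇒≥; m≤n+m;
         ≤-totalOrder; module ≤-Reasoning)
open import Data.Fin using (Fin; zero; suc; toℕ; fromℕ<)
import Data.Fin as Fin
open import Data.Fin.Properties using (toℕ<n; toℕ-fromℕ<)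
open import Data.Product using (Σ; ∃-syntax; _×_; _,_; proj₁; proj₂)
open import Data.Sum using (inj₁; inj₂)
open import Data.Maybe using (Maybe; just; nothing)
open import Data.List using (List; []; _∷_; [_]; _++_; length; map; filter; concatMap; allFin)
open import Data.List.Properties using (length-++; filter-notAll; length-tabulate)
open import Data.List.Relation.Unary.All using (All; []; _∷_; lookup)
open import Data.List.Relation.Unary.Any as Any using (here; there; satisfied)
open import Data.List.Membership.Propositional using (_∈_; _∉_; lose)
open import Data.List.Membership.Propositional.Properties
  using (∈-++⁺ˡ; ∈-++⁺ʳ; ∈-++⁻; ∈-map⁺; ∈-map⁻; ∈-filter⁺; ∈-filter⁻;
         ∈-concatMap⁺; ∈-concatMap⁻; ∈-allFin)
open import Data.List.Membership.DecPropositional _≟_ using (_∈?_)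
open import Data.List.Extrema ≤-totalOrder using (argmin; argmin-sel; f[argmin]≤f[⊤]; f[argmin]≤f[xs])
open import Data.Vec.Functional using (updateAt)
open import Data.Vec.Functional.Properties using (updateAt-updates; updateAt-minimal)
open import Data.Empty using (⊥; ⊥-elim)
open import Function using (id; const; _∘_)
open import Relation.Nullary using (yes; no; ¬_)
open import Relation.Nullary.Decidable using (¬?)
open import Relation.Binary.PropositionalEquality using (_≡_; refl; sym; trans; cong; subst)

module _ {A : Set} where

  least : List (ℕ × A) → Maybe (ℕ × A)
  least []       = nothing
  least (x ∷ xs) = just (argmin proj₁ x xs)

  least-∈ : ∀ xs {r} → least xs ≡ just r → r ∈ xs
  least-∈ (x ∷ xs) refl with argmin-sel proj₁ x xs
  ... | inj₁ r≡x  = here r≡x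
  ... | inj₂ r∈xs = there r∈xs

  least-≤ : ∀ xs {r} → least xs ≡ just r → All (λ y → proj₁ r ≤ proj₁ y) xs
  least-≤ (x ∷ xs) refl = f[argmin]≤f[⊤] {f = proj₁} x xs ∷ f[argmin]≤f[xs] {f = proj₁} x xs

  least-just : ∀ {xs x} → x ∈ xs → ∃[ r ] least xs ≡ just r
  least-just {_ ∷ _} _ = _ , refl

  least-minimal : ∀ xs {r y} → least xs ≡ just r → y ∈ xs → proj₁ r ≤ proj₁ y
  least-minimal xs eq = lookup (least-≤ xs eq)

  least-++-above⁺ : ∀ xs {ys k c} → All (λ y → k < proj₁ y) ys →
                    least xs ≡ just (k , c) → ∃[ c' ] least (xs ++ ys) ≡ just (k , c')
  least-++-above⁺ xs {ys} {k} above eq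
    with least-just {xs ++ ys} (∈-++⁺ˡ (least-∈ xs eq))
  ... | (k' , c') , eq' with ∈-++⁻ xs (least-∈ (xs ++ ys) eq')
  ... | inj₂ r∈ys = ⊥-elim (<-irrefl refl
          (≤-trans (lookup above r∈ys) (least-minimal (xs ++ ys) eq' (∈-++⁺ˡ (least-∈ xs eq)))))
  ... | inj₁ r∈xs = c' , subst (λ t → least (xs ++ ys) ≡ just (t , c')) k'≡k eq'
    where
    k'≡k : k' ≡ k
    k'≡k = ≤-antisym (least-minimal (xs ++ ys) eq' (∈-++⁺ˡ (least-∈ xs eq)))
                     (least-minimal xs eq r∈xs)

  least-++-above⁻ : ∀ xs {ys k c} → All (λ y → k < proj₁ y) ys →
                    least (xs ++ ys) ≡ just (k , c) → ∃[ c' ] least xs ≡ just (k , c')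
  least-++-above⁻ xs {ys} {k} above eq with ∈-++⁻ xs (least-∈ (xs ++ ys) eq)
  ... | inj₂ r∈ys = ⊥-elim (<-irrefl refl (lookup above r∈ys))
  ... | inj₁ r∈xs with least-just r∈xs
  ... | (k' , c') , eq' = c' , subst (λ t → least xs ≡ just (t , c')) k'≡k eq'
    where
    k'≡k : k' ≡ k
    k'≡k = ≤-antisym (least-minimal xs eq' r∈xs)
                     (least-minimal (xs ++ ys) eq (∈-++⁺ˡ (least-∈ xs eq')))

length-filter-≢-< : ∀ {n xs} → n ∈ xs → length (filter (¬? ∘ (_≟ n)) xs) < length xs
length-filter-≢-< {n} {xs} n∈xs =
  filter-notAll (¬? ∘ (_≟ n)) xs (Any.map (λ { refl n≢n → n≢n refl }) n∈xs)

∃∉-below : ∀ n (xs : List ℕ) → length xs < n → ∃[ j ] j < n × j ∉ xs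
∃∉-below (suc n) xs len with n ∈? xs
... | no n∉xs  = n , ≤-refl , n∉xs
... | yes n∈xs with ∃∉-below n (filter (¬? ∘ (_≟ n)) xs) (≤-trans (length-filter-≢-< n∈xs) (≤-pred len))
... | j , j<n , j∉ = j , m≤n⇒m≤1+n j<n , λ j∈xs → j∉ (∈-filter⁺ (¬? ∘ (_≟ n)) j∈xs (<⇒≢ j<n))

length-concatMap-≤ : ∀ {A B : Set} {c} (f : A → List B) → (∀ x → length (f x) ≤ c) →
                     ∀ xs → length (concatMap f xs) ≤ length xs * c
length-concatMap-≤ f bound []       = z≤n
length-concatMap-≤ f bound (x ∷ xs) rewrite length-++ (f x) {concatMap f xs} =
  +-mono-≤ (bound x) (length-concatMap-≤ f bound xs)

length-concatMap-allFin-≤ : ∀ {B : Set} {a c} (f : Fin a → List B) → (∀ i → length (f i) ≤ c) →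
                            length (concatMap f (allFin a)) ≤ a * c
length-concatMap-allFin-≤ {a = a} {c} f bound =
  subst (λ n → length (concatMap f (allFin a)) ≤ n * c) (length-tabulate {n = a} id)
        (length-concatMap-≤ f bound (allFin a))

∈-concatMap-allFin⁺ : ∀ {B : Set} {a} (f : Fin a → List B) i {x} → x ∈ f i → x ∈ concatMap f (allFin a)
∈-concatMap-allFin⁺ f i x∈ = ∈-concatMap⁺ f (lose (∈-allFin i) x∈)

module _ {n : ℕ} where

  relay : Maybe (ℕ × Cause n) → ℕ → Cause n → List (ℕ × Cause n)
  relay nothing        t c = []
  relay (just (s , _)) t c with s ≟ t
  ... | yes _ = [ (suc t , c) ]
  ... | no _  = []

  relay-∈⁺ : ∀ {r t c c'} → r ≡ just (t , c') → (suc t , c) ∈ relay r t c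
  relay-∈⁺ {t = t} refl with t ≟ t
  ... | yes _   = here refl
  ... | no t≢t = ⊥-elim (t≢t refl)

  relay-∈⁻ : ∀ r {t c x} → x ∈ relay r t c → (∃[ c' ] r ≡ just (t , c')) × x ≡ (suc t , c)
  relay-∈⁻ (just (s , c')) {t} x∈ with s ≟ t
  relay-∈⁻ (just (s , c')) (here refl) | yes refl = (c' , refl) , refl

  relay-later : ∀ r {t c} → All (λ y → t < proj₁ y) (relay r t c)
  relay-later nothing        = []
  relay-later (just (s , _)) {t} with s ≟ t
  ... | yes _ = ≤-refl ∷ []
  ... | no _  = []

  seedCandidates : List (Fin n × ℕ) → Fin n → List (ℕ × Cause n)
  seedCandidates S v = map (λ s → proj₂ s , seed) (filter (λ s → proj₁ s Fin.≟ v) S)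

  seedCandidates-∈⁺ : ∀ S {v t} → (v , t) ∈ S → (t , seed) ∈ seedCandidates S v
  seedCandidates-∈⁺ S s∈S = ∈-map⁺ _ (∈-filter⁺ _ s∈S refl)

  seedCandidates-∈⁻ : ∀ S {v t c} → (t , c) ∈ seedCandidates S v → c ≡ seed × (v , t) ∈ S
  seedCandidates-∈⁻ S {v} x∈ with ∈-map⁻ _ x∈
  ... | (u , t) , s∈ , refl with ∈-filter⁻ (λ s → proj₁ s Fin.≟ v) s∈
  ... | s∈S , refl = refl , s∈S

Transmits : (G : SimpleGraph) → Labeling G → ℕ → Log G → Fin (nV G) → Fin (nV G) → ℕ → Set
Transmits G lab δ L u w t = ∃[ e ] Joins G e u w × lab e ≡ t × Infectious G δ L w t

module _ (G : SimpleGraph) (lab : Labeling G) (δ : ℕ) (S : SeedSet G)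
         (relays : Fin (nV G) → List (ℕ × Cause (nV G))) where

  candidateLog : Log G
  candidateLog v = least (seedCandidates S v ++ relays v)

  candidateLog-possible :
    (∀ u {t c} → (t , c) ∈ relays u → ∃[ w ] c ≡ by w × Transmits G lab δ candidateLog u w t) →
    (∀ u w e → Joins G e u w → Infectious G δ candidateLog w (lab e) →
       ∃[ x ] x ∈ relays u × proj₁ x ≤ lab e) →
    PossibleLog G lab δ S candidateLog
  candidateLog-possible relays-sound relays-complete = record
    { seedSound  = seedSound
    ; byInfSound = byInfSound
    ; complete   = complete
    }
    where
    entry-∈ : ∀ u {r} → candidateLog u ≡ just r → r ∈ seedCandidates S u ++ relays u
    entry-∈ u = least-∈ (seedCandidates S u ++ relays u)

    infectedBy : ∀ u {x t} → x ∈ seedCandidates S u ++ relays u → proj₁ x ≤ t →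
                 InfectedBy G candidateLog u t
    infectedBy u x∈ x≤t with least-just x∈
    ... | (t' , c) , eq = t' , (c , eq) , ≤-trans (least-minimal _ eq x∈) x≤t

    seedSound : ∀ u t → candidateLog u ≡ just (t , seed) → (u , t) ∈ S
    seedSound u t eq with ∈-++⁻ (seedCandidates S u) (entry-∈ u eq)
    ... | inj₁ x∈ = proj₂ (seedCandidates-∈⁻ S x∈)
    ... | inj₂ x∈ with relays-sound u x∈
    ... | _ , () , _

    byInfSound : ∀ u w t → candidateLog u ≡ just (t , by w) → Transmits G lab δ candidateLog u w t
    byInfSound u w t eq with ∈-++⁻ (seedCandidates S u) (entry-∈ u eq)
    ... | inj₁ x∈ with seedCandidates-∈⁻ S x∈
    ... | () , _
    byInfSound u w t eq | inj₂ x∈ with relays-sound u x∈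
    ... | _ , refl , transmits = transmits

    complete : ∀ u t → Trigger G lab δ S candidateLog u t → InfectedBy G candidateLog u t
    complete u t (inj₁ s∈S) = infectedBy u (∈-++⁺ˡ (seedCandidates-∈⁺ S s∈S)) ≤-refl
    complete u t (inj₂ (w , e , joins , refl , infectious))
      with relays-complete u w e joins infectious
    ... | x , x∈ , x≤t = infectedBy u (∈-++⁺ʳ (seedCandidates S u) x∈) x≤t

relabel-possible : ∀ G lab δ S L e v → PossibleLog G lab δ S L →
                   (∀ u w t → L u ≡ just (t , by w) → ¬ Joins G e u w) →
                   (∀ u w → Joins G e u w → ¬ Infectious G δ L w v) →
                   PossibleLog G (updateAt lab e (const v)) δ S L
relabel-possible G lab δ S L e v possible unused silent = record
  { seedSound  = PossibleLog.seedSound possible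
  ; byInfSound = byInfSound
  ; complete   = complete
  }
  where
  lab' = updateAt lab e (const v)

  byInfSound : ∀ u w t → L u ≡ just (t , by w) → Transmits G lab' δ L u w t
  byInfSound u w t eq with PossibleLog.byInfSound possible u w t eq
  ... | e' , joins , refl , infectious with e' Fin.≟ e
  ... | yes refl = ⊥-elim (unused u w t eq joins)
  ... | no e'≢e  = e' , joins , updateAt-minimal e' e lab e'≢e , infectious

  complete : ∀ u t → Trigger G lab' δ S L u t → InfectedBy G L u t
  complete u t (inj₁ s∈S) = PossibleLog.complete possible u t (inj₁ s∈S)
  complete u t (inj₂ (w , e' , joins , refl , infectious)) with e' Fin.≟ e
  ... | yes refl =
    ⊥-elim (silent u w joins (subst (Infectious G δ L w) (updateAt-updates e lab) infectious))
  ... | no e'≢e  = PossibleLog.complete possible u t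
                     (inj₂ (w , e' , joins , sym (updateAt-minimal e' e lab e'≢e) , infectious))

updateAt-valid : ∀ G {Tmax lab} e {v} → ValidLabeling G Tmax lab → 1 ≤ v → v ≤ Tmax →
                 ValidLabeling G Tmax (updateAt lab e (const v))
updateAt-valid G {Tmax} {lab} e valid 1≤v v≤T e' with e' Fin.≟ e
... | yes refl = subst (λ x → 1 ≤ x × x ≤ Tmax) (sym (updateAt-updates e lab)) (1≤v , v≤T)
... | no e'≢e  = subst (λ x → 1 ≤ x × x ≤ Tmax) (sym (updateAt-minimal e' e lab e'≢e)) (valid e')

module _ (G : SimpleGraph) (L : Log G) (w : Fin (nV G)) where

  infectedAt⇒infectious₁ : ∀ {t} → InfectedAt G L w t → Infectious G 1 L w (suc t)
  infectedAt⇒infectious₁ {t} at = t , at , ≤-refl , ≤-reflexive (+-comm 1 t)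

  infectious₁⇒infectedAt : ∀ {t} → Infectious G 1 L w (suc t) → InfectedAt G L w t
  infectious₁⇒infectedAt {t} (t' , at , t'<1+t , 1+t≤t'+1) = subst (InfectedAt G L w) t'≡t at
    where
    t'≡t : t' ≡ t
    t'≡t = ≤-antisym (≤-pred t'<1+t) (≤-pred (subst (suc t ≤_) (+-comm t' 1) 1+t≤t'+1))

module Star (m : ℕ) where

  star : SimpleGraph
  star = record
    { nV       = suc m
    ; nE       = m
    ; ends     = λ i → zero , suc i
    ; loopless = λ _ ()
    ; noMulti  = λ { _ _ (inj₁ refl) → refl ; _ _ (inj₂ ()) }
    }

  starLabel : Labeling star
  starLabel i = suc (toℕ i)

  starLabel-valid : ValidLabeling star m starLabel
  starLabel-valid i = s≤s z≤n , toℕ<n i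

  starTemporal : TemporalGraph
  starTemporal = record { graph = star ; Tmax = m ; label = starLabel ; labelOK = starLabel-valid }

  -- Leaf i + 1 can infect the center along edge i only if it was infected at exactly time i, and
  -- an infection coming back from the center arrives later; so the center's relayed infections
  -- depend only on the leaves' seeds, and the leaves' only on the center's resulting log.
  centerRelays : SeedSet star → List (ℕ × Cause (suc m))
  centerRelays S =
    concatMap (λ i → relay (least (seedCandidates S (suc i))) (toℕ i) (by (suc i))) (allFin m)

  starRelays : SeedSet star → Fin (suc m) → List (ℕ × Cause (suc m))
  starRelays S zero    = centerRelays S
  starRelays S (suc i) = relay (least (seedCandidates S zero ++ centerRelays S)) (toℕ i) (by zero)

  starLog : SeedSet star → Log star
  starLog S = candidateLog star starLabel 1 S (starRelays S)

  leaf-infectedAt⁺ : ∀ S i {c} → least (seedCandidates S (suc i)) ≡ just (toℕ i , c) →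
                     InfectedAt star (starLog S) (suc i) (toℕ i)
  leaf-infectedAt⁺ S i = least-++-above⁺ (seedCandidates S (suc i)) (relay-later (starLog S zero))

  leaf-infectedAt⁻ : ∀ S i → InfectedAt star (starLog S) (suc i) (toℕ i) →
                     ∃[ c ] least (seedCandidates S (suc i)) ≡ just (toℕ i , c)
  leaf-infectedAt⁻ S i (_ , eq) =
    least-++-above⁻ (seedCandidates S (suc i)) (relay-later (starLog S zero)) eq

  starLog-possible : ∀ S → PossibleLog star starLabel 1 S (starLog S)
  starLog-possible S = candidateLog-possible star starLabel 1 S (starRelays S) sound complete
    where
    sound : ∀ u {t c} → (t , c) ∈ starRelays S u →
            ∃[ w ] c ≡ by w × Transmits star starLabel 1 (starLog S) u w t
    sound zero x∈ with satisfied (∈-concatMap⁻ _ {xs = allFin m} x∈)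
    ... | i , x∈ᵢ with relay-∈⁻ (least (seedCandidates S (suc i))) x∈ᵢ
    ... | (_ , eq) , refl =
      suc i , refl , i , inj₁ refl , refl ,
      infectedAt⇒infectious₁ star (starLog S) (suc i) (leaf-infectedAt⁺ S i eq)
    sound (suc i) x∈ with relay-∈⁻ (starLog S zero) x∈
    ... | (c , eq) , refl =
      zero , refl , i , inj₂ refl , refl , infectedAt⇒infectious₁ star (starLog S) zero (c , eq)

    complete : ∀ u w e → Joins star e u w → Infectious star 1 (starLog S) w (starLabel e) →
               ∃[ x ] x ∈ starRelays S u × proj₁ x ≤ starLabel e
    complete _ _ e (inj₁ refl) infectious
      with leaf-infectedAt⁻ S e (infectious₁⇒infectedAt star (starLog S) (suc e) infectious)
    ... | _ , eq = _ , ∈-concatMap-allFin⁺ _ e (relay-∈⁺ eq) , ≤-refl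
    complete _ _ e (inj₂ refl) infectious with infectious₁⇒infectedAt star (starLog S) zero infectious
    ... | _ , eq = _ , relay-∈⁺ eq , ≤-refl

  -- Edge indices a log of the center can reveal: the edge it was infected through and, as its
  -- infection time t, the edge with label t + 1.
  leafIndex : Cause (suc m) → List ℕ
  leafIndex (by (suc i)) = [ toℕ i ]
  leafIndex _            = []

  centerTrace : Maybe (ℕ × Cause (suc m)) → List ℕ
  centerTrace nothing        = []
  centerTrace (just (t , c)) = t ∷ leafIndex c

  infectionTime : Maybe (ℕ × Cause (suc m)) → List ℕ
  infectionTime nothing        = []
  infectionTime (just (t , _)) = [ t ]

  endpointTimes : Log star → Fin m → List ℕ
  endpointTimes L e = infectionTime (L zero) ++ infectionTime (L (suc e))

  length-centerTrace : ∀ r → length (centerTrace r) ≤ 2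
  length-centerTrace nothing                 = z≤n
  length-centerTrace (just (_ , seed))       = s≤s z≤n
  length-centerTrace (just (_ , by zero))    = s≤s z≤n
  length-centerTrace (just (_ , by (suc _))) = s≤s (s≤s z≤n)

  length-infectionTime : ∀ r → length (infectionTime r) ≤ 1
  length-infectionTime nothing  = z≤n
  length-infectionTime (just _) = s≤s z≤n

  length-endpointTimes : ∀ L e → length (endpointTimes L e) ≤ 2
  length-endpointTimes L e rewrite length-++ (infectionTime (L zero)) {infectionTime (L (suc e))} =
    +-mono-≤ (length-infectionTime (L zero)) (length-infectionTime (L (suc e)))

  unused-edge : ∀ {S L} e → PossibleLog star starLabel 1 S L → toℕ e ∉ centerTrace (L zero) →
                ∀ u w t → L u ≡ just (t , by w) → ¬ Joins star e u w
  unused-edge e _ ∉trace u w t eq (inj₁ refl) =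
    ∉trace (subst (λ r → toℕ e ∈ centerTrace r) (sym eq) (there (here refl)))
  unused-edge {L = L} e possible ∉trace u w t eq (inj₂ refl)
    with PossibleLog.byInfSound possible u w t eq
  ... | _ , inj₁ () , _
  ... | _ , inj₂ refl , refl , infectious with infectious₁⇒infectedAt star L zero infectious
  ... | _ , eq' = ∉trace (subst (λ r → toℕ e ∈ centerTrace r) (sym eq') (here refl))

  silent-edge : ∀ L e {j} → j ∉ endpointTimes L e →
                ∀ u w → Joins star e u w → ¬ Infectious star 1 L w (suc j)
  silent-edge L e ∉times _ _ (inj₁ refl) infectious
    with infectious₁⇒infectedAt star L (suc e) infectious
  ... | _ , eq = ∉times (∈-++⁺ʳ (infectionTime (L zero))
                          (subst (λ r → _ ∈ infectionTime r) (sym eq) (here refl)))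
  silent-edge L e ∉times _ _ (inj₂ refl) infectious
    with infectious₁⇒infectedAt star L zero infectious
  ... | _ , eq = ∉times (∈-++⁺ˡ (subst (λ r → _ ∈ infectionTime r) (sym eq) (here refl)))

  relabelled-possible : ∀ S e j → toℕ e ∉ centerTrace (starLog S zero) →
                        j ∉ endpointTimes (starLog S) e →
                        PossibleLog star (updateAt starLabel e (const (suc j))) 1 S (starLog S)
  relabelled-possible S e j ∉trace ∉times =
    relabel-possible star starLabel 1 S (starLog S) e (suc j) (starLog-possible S)
      (unused-edge e (starLog-possible S) ∉trace) (silent-edge (starLog S) e ∉times)

  no-short-schedule : ∀ {k a S} → WitnessingSchedule starTemporal 1 k a S → suc (a * 2) < m → ⊥
  no-short-schedule {a = a} {S} (_ , determined) short =
    j∉avoided (here (suc-injective relabelling-forced))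
    where
    L : Fin a → Log star
    L i = starLog (S i)

    traces : List ℕ
    traces = concatMap (λ i → centerTrace (L i zero)) (allFin a)

    traces-short : length traces < m
    traces-short = ≤-trans (s≤s (length-concatMap-allFin-≤ _ (λ i → length-centerTrace (L i zero))))
                           (≤-trans (n≤1+n _) short)

    fresh-edge : ∃[ n ] n < m × n ∉ traces
    fresh-edge = ∃∉-below m traces traces-short

    e : Fin m
    e = fromℕ< (proj₁ (proj₂ fresh-edge))

    e-unused : ∀ i → toℕ e ∉ centerTrace (L i zero)
    e-unused i ∈trace = proj₂ (proj₂ fresh-edge)
      (subst (_∈ traces) (toℕ-fromℕ< _) (∈-concatMap-allFin⁺ _ i ∈trace))

    avoided : List ℕ
    avoided = toℕ e ∷ concatMap (λ i → endpointTimes (L i) e) (allFin a)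

    avoided-short : length avoided < m
    avoided-short =
      ≤-trans (s≤s (s≤s (length-concatMap-allFin-≤ _ (λ i → length-endpointTimes (L i) e)))) short

    fresh-label : ∃[ j ] j < m × j ∉ avoided
    fresh-label = ∃∉-below m avoided avoided-short

    j = proj₁ fresh-label
    j∉avoided = proj₂ (proj₂ fresh-label)

    relabelling-forced : suc j ≡ suc (toℕ e)
    relabelling-forced = trans (sym (updateAt-updates e starLabel))
      (determined L (λ i → starLog-possible (S i)) (updateAt starLabel e (const (suc j)))
        (updateAt-valid star e starLabel-valid (s≤s z≤n) (proj₁ (proj₂ fresh-label)))
        (λ i → relabelled-possible (S i) e j (e-unused i) (j∉avoided ∘ there ∘ ∈-concatMap-allFin⁺ _ i))
        e)

  schedule-length : ∀ {k a S} → WitnessingSchedule starTemporal 1 k a S → m ≤ suc (a * 2)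
  schedule-length witnessing = ≮⇒≥ (no-short-schedule witnessing)

linear-bound : ∀ {m a} → 2 ≤ m → m ≤ suc (a * 2) → 1 * m ≤ 3 * a
linear-bound {a = zero} 2≤m m≤1 with ≤-trans 2≤m m≤1
... | s≤s ()
linear-bound {m} {a@(suc _)} _ m≤1+2a = begin
  1 * m     ≡⟨ *-identityˡ m ⟩
  m         ≤⟨ m≤1+2a ⟩
  1 + a * 2 ≤⟨ +-monoˡ-≤ (a * 2) (s≤s z≤n) ⟩
  a + a * 2 ≡⟨ cong (a +_) (*-comm a 2) ⟩
  3 * a     ∎
  where open ≤-Reasoning

starInstance : ℕ → Instance
starInstance n = record { tgraph = Star.starTemporal (2 + n) ; delta = 1 ; deltaPos = ≤-refl }

mainTheorem2 :
    Σ ℕ λ p → Σ ℕ λ q → 1 ≤ p × 1 ≤ q ×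
    Σ (ℕ → Instance) λ fam →
      (∀ (M : ℕ) → Σ ℕ λ N → ∀ (n : ℕ) → N ≤ n → M ≤ numEdges (fam n)) ×
      (∀ (n k : ℕ) → 1 ≤ k →
         WitnessComplexity≥ (tgraph (fam n)) (delta (fam n)) k
           p q (numEdges (fam n)))
mainTheorem2 =
  1 , 3 , ≤-refl , s≤s z≤n , starInstance ,
  (λ M → M , λ n M≤n → ≤-trans M≤n (m≤n+m n 2)) ,
  λ n k _ a S witnessing →
    linear-bound {a = a} (s≤s (s≤s z≤n)) (Star.schedule-length (2 + n) witnessing)
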